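{- If a trihex with signature $(s,b,f)$ has coinciding signatures, then $b+1$ divides both $s+1$ and $f$.
   Context: A trihex is a 3-regular graph embedded in the plane (equivalently the sphere) whose faces all have 3 or 6 sides, considered up to orientation-preserving homeomorphism. Every trihex arises as the quotient of the regular hexagonal tiling of the plane, positioned so the hexagons lie in vertical columns, by the group generated by $180^\circ$ rotations about the centers of a set of "special" hexagons whose centers form the vertices of a parallelogram lattice. Columns containing special hexagons are spine columns, the others belt columns. The spine length $s\ge0$ is the number of hexagons strictly between two consecutive special hexagons in a spine column; $b\ge0$ is the number of belt columns between two adjacent spine columns; the offset $f\in[0,s]$ is defined by: translating a special hexagon $b+1$ columns in the SW-to-NE direction lands it $f$ hexagons below a special hexagon. $(s,b,f)$ is a signature. The columns in the directions $60^\circ$ and $120^\circ$ clockwise from north give two further signatures; these three are the equivalent signatures. If $(s_1,b_1,f_1)$ is one signature and $h=2s_1b_1+2s_1+2b_1$, the others are: $s_2=j_2(b_1+1)-1$ with $j_2$ the order of $f_1$ in $\mathbb{Z}_{s_1+1}$; $b_2=\frac{h-2s_2}{2s_2+2}$; $f_2\equiv -p_2(b_1+1)-(b_2+1)\pmod{s_2+1}$ with $p_2$ the least positive integer such that $p_2f_1\equiv b_2+1\pmod{s_1+1}$; $s_3=j_3(b_1+1)-1$ with $j_3$ the order of $f_1+b_1+1$ in $\mathbb{Z}_{s_1+1}$; $b_3=\frac{h-2s_3}{2s_3+2}$; $f_3\equiv -p_3(b_1+1)\pmod{s_3+1}$ with $p_3$ the least positive integer such that $p_3(f_1+b_1+1)\equiv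 b_3+1\pmod{s_1+1}$. A trihex has coinciding signatures if its three equivalent signatures are the same triple. -}

module Defs where

open import Data.Nat using (ℕ; zero; suc; _+_; _*_; _≤_; _<_)
open import Data.Nat.DivMod using (_%_)
open import Data.Nat.Divisibility using (_∣_)
open import Data.Product using (Σ; _×_; ∃-syntax)
open import Relation.Binary.PropositionalEquality using (_≡_)

_≡_[mod1+_] : ℕ → ℕ → ℕ → Set
a ≡ c [mod1+ n ] = a % suc n ≡ c % suc n

IsOrder : (n a j : ℕ) → Set
IsOrder n a j =
  (0 < j) × ((j * a) ≡ 0 [mod1+ n ]) ×
  (∀ k → 0 < k → (k * a) ≡ 0 [mod1+ n ] → j ≤ k)

IsLeastPos : (n a c p : ℕ) → Set
IsLeastPos n a c p =
  (0 < p) × ((p * a) ≡ c [mod1+ n ]) ×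
  (∀ q → 0 < q → (q * a) ≡ c [mod1+ n ] → p ≤ q)

hval : ℕ → ℕ → ℕ
hval s b = 2 * s * b + 2 * s + 2 * b

IsSignature : ℕ → ℕ → ℕ → Set
IsSignature s b f = f ≤ s

-- (s₂,b₂,f₂) is the second equivalent signature of (s,b,f):
--   s₂ = j₂(b+1) - 1, j₂ the order of f in ℤ_{s+1}
--   b₂ = (h - 2 s₂)/(2 s₂ + 2)   (stated as b₂(2s₂+2) + 2s₂ = h)
--   f₂ ∈ [0,s₂], f₂ ≡ -p₂(b+1) - (b₂+1) (mod s₂+1),
--   p₂ least positive with p₂ f ≡ b₂+1 (mod s+1)
SecondSignature : (s b f s₂ b₂ f₂ : ℕ) → Set
SecondSignature s b f s₂ b₂ f₂ =
  ∃[ j₂ ] ∃[ p₂ ]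
    IsOrder s f j₂ ×
    (suc s₂ ≡ j₂ * suc b) ×
    (b₂ * (2 * s₂ + 2) + 2 * s₂ ≡ hval s b) ×
    IsLeastPos s f (suc b₂) p₂ ×
    (suc s₂ ∣ f₂ + p₂ * suc b + suc b₂) ×
    (f₂ ≤ s₂)

-- (s₃,b₃,f₃) is the third equivalent signature of (s,b,f):
--   s₃ = j₃(b+1) - 1, j₃ the order of f+b+1 in ℤ_{s+1}
--   b₃ = (h - 2 s₃)/(2 s₃ + 2)
--   f₃ ∈ [0,s₃], f₃ ≡ -p₃(b+1) (mod s₃+1),
--   p₃ least positive with p₃(f+b+1) ≡ b₃+1 (mod s+1)
ThirdSignature : (s b f s₃ b₃ f₃ : ℕ) → Set
ThirdSignature s b f s₃ b₃ f₃ =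
  ∃[ j₃ ] ∃[ p₃ ]
    IsOrder s (f + suc b) j₃ ×
    (suc s₃ ≡ j₃ * suc b) ×
    (b₃ * (2 * s₃ + 2) + 2 * s₃ ≡ hval s b) ×
    IsLeastPos s (f + suc b) (suc b₃) p₃ ×
    (suc s₃ ∣ f₃ + p₃ * suc b) ×
    (f₃ ≤ s₃)

CoincidingSignatures : ℕ → ℕ → ℕ → Set
CoincidingSignatures s b f =
  SecondSignature s b f s b f × ThirdSignature s b f s b f

{-# OPTIONS --safe #-}
module Submission where

open import Defs
open import Data.Nat using (ℕ; suc; _+_; _*_)
open import Data.Nat.Properties using (+-comm)
open import Data.Nat.Divisibility using (_∣_; divides; ∣-trans; ∣m+n∣m⇒∣n; n∣m*n)
open import Data.Product using (_×_; _,_)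
open import Relation.Binary.PropositionalEquality using (subst)

ThirdSignature⇒1+b∣1+s₃ : ∀ {s b f s₃ b₃ f₃} → ThirdSignature s b f s₃ b₃ f₃ →
                          suc b ∣ suc s₃
ThirdSignature⇒1+b∣1+s₃ (j₃ , _ , _ , 1+s₃≡j₃*[1+b] , _) = divides j₃ 1+s₃≡j₃*[1+b]

ThirdSignature⇒1+b∣f₃ : ∀ {s b f s₃ b₃ f₃} → ThirdSignature s b f s₃ b₃ f₃ →
                        suc b ∣ f₃
ThirdSignature⇒1+b∣f₃ {b = b} {f₃ = f₃} sig@(_ , p₃ , _ , _ , _ , _ , 1+s₃∣f₃+p₃[1+b] , _) =
  ∣m+n∣m⇒∣n 1+b∣p₃[1+b]+f₃ (n∣m*n p₃)
  where
  1+b∣p₃[1+b]+f₃ : suc b ∣ p₃ * suc b + f₃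
  1+b∣p₃[1+b]+f₃ = subst (suc b ∣_) (+-comm f₃ (p₃ * suc b))
                         (∣-trans (ThirdSignature⇒1+b∣1+s₃ sig) 1+s₃∣f₃+p₃[1+b])

lemma3 : (s b f : ℕ) → IsSignature s b f → CoincidingSignatures s b f →
           (suc b ∣ suc s) × (suc b ∣ f)
lemma3 s b f _ (_ , third) = ThirdSignature⇒1+b∣1+s₃ third , ThirdSignature⇒1+b∣f₃ third
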